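{- Let $d\ge 2$ be an integer, let $H$ be a bipartite graph, and let $G = H\circ P_d$ have order $n$. Then $\gamma_d^1(G)=\frac{n}{d+1}$.
   Context: $P_d$ denotes the path on $d$ vertices. The $P_d$-corona $H\circ P_d$ of a graph $H$ is the graph obtained from $H$ and $|V(H)|$ disjoint copies of $P_d$ by adding, for each vertex $v$ of $H$, an edge between $v$ and an end vertex of its own copy of $P_d$. For a graph $G$, a set $S\subseteq V(G)$ is a $d$-distance dominating set if every vertex $u\notin S$ is at distance at most $d$ from some vertex of $S$; $\gamma_d^1(G)$ is the minimum size of an independent $d$-distance dominating set of $G$. -}

module Defs where

open import Data.Nat using (ℕ; zero; suc; _*_; _≤_)
open import Data.Fin using (Fin; toℕ; remQuot)
open import Data.Fin.Subset using (Subset; _∈_; _∉_; ∣_∣)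
open import Data.Bool using (Bool)
open import Data.Product using (_×_; _,_; ∃; ∃-syntax; Σ-syntax)
open import Data.Sum using (_⊎_)
open import Relation.Binary.PropositionalEquality using (_≡_; _≢_)
open import Relation.Nullary using (¬_)

record Graph (n : ℕ) : Set₁ where
  field
    Adj : Fin n → Fin n → Set
open Graph public

IsSimple : ∀ {n} → Graph n → Set
IsSimple G = (∀ u v → Adj G u v → Adj G v u) × (∀ v → ¬ Adj G v v)

IsBipartite : ∀ {n} → Graph n → Set
IsBipartite {n} G = Σ[ c ∈ (Fin n → Bool) ] (∀ u v → Adj G u v → c u ≢ c v)

data Walk {n} (G : Graph n) : ℕ → Fin n → Fin n → Set where
  here : ∀ {v} → Walk G zero v v
  step : ∀ {k u w v} → Adj G u w → Walk G k w v → Walk G (suc k) u v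

DistLe : ∀ {n} → Graph n → ℕ → Fin n → Fin n → Set
DistLe G d u v = ∃[ k ] (k ≤ d × Walk G k u v)

IsIndependent : ∀ {n} → Graph n → Subset n → Set
IsIndependent G S = ∀ u v → u ∈ S → v ∈ S → ¬ Adj G u v

IsDistDominating : ∀ {n} → Graph n → ℕ → Subset n → Set
IsDistDominating G d S = ∀ u → u ∉ S → ∃[ s ] (s ∈ S × DistLe G d u s)

IsIndepDistDom : ∀ {n} → Graph n → ℕ → Subset n → Set
IsIndepDistDom G d S = IsIndependent G S × IsDistDominating G d S

IsIndepDistDomNumber : ∀ {n} → Graph n → ℕ → ℕ → Set
IsIndepDistDomNumber G d k =
  (∃[ S ] (IsIndepDistDom G d S × ∣ S ∣ ≡ k)) ×
  (∀ S → IsIndepDistDom G d S → k ≤ ∣ S ∣)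

-- Vertex x corresponds to remQuot x = (v , i) : Fin m × Fin (suc d);
-- (v , 0) is the vertex v of H, and (v , 1), …, (v , d) is the copy of P_d
-- attached to v, with (v , 1) the end vertex adjacent to v.
CoronaAdj : ∀ {m} d → Graph m → Fin m × Fin (suc d) → Fin m × Fin (suc d) → Set
CoronaAdj d H (u , i) (v , j) =
  (toℕ i ≡ 0 × toℕ j ≡ 0 × Adj H u v) ⊎
  (u ≡ v × (toℕ j ≡ suc (toℕ i) ⊎ toℕ i ≡ suc (toℕ j)))

corona : ∀ {m} → Graph m → (d : ℕ) → Graph (m * suc d)
corona H d = record { Adj = λ x y → CoronaAdj d H (remQuot (suc d) x) (remQuot (suc d) y) }

-- Call a vertex v of H together with its pendant path a column, with levels 0 (v) to d.
-- Taking the level-1 vertex of every column gives m pairwise non-adjacent vertices, and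
-- every vertex of a column lies within distance d of its level-1 vertex.  Conversely, a
-- walk that leaves a column must pass through level 0, so the level-d vertex of a column
-- is reached in at most d steps only from inside that column.  Hence every d-distance
-- dominating set meets all m columns, and γ = m = n / (d + 1).
module Submission where

open import Defs
open import Data.Nat using (ℕ; zero; suc; _+_; _*_; _≤_; z≤n; s≤s; s≤s⁻¹)
open import Data.Nat.Properties using (≤-trans; m≤n⇒m≤1+n; suc-injective; <⇒≤; +-mono-≤; *-identityʳ; module ≤-Reasoning)
open import Data.Product using (_×_; _,_; proj₁; proj₂; ∃-syntax)
open import Data.Sum using (inj₁; inj₂)
open import Data.Fin using (Fin; zero; suc; toℕ; fromℕ; inject₁; combine; remQuot)
open import Data.Fin.Properties using (remQuot-combine; combine-remQuot; toℕ-inject₁; toℕ<n; toℕ-fromℕ)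
open import Data.Fin.Subset using (Subset; _∈_; Nonempty; ⁅_⁆; inside; outside; ∣_∣)
open import Data.Fin.Subset.Properties using (_∈?_; x∈⁅x⁆; x∈⁅y⁆⇒x≡y; ∣⁅x⁆∣≡1; x∈p⇒∣p-x∣<∣p∣)
open import Data.Vec using (Vec; []; _∷_; _++_; concat; replicate; lookup; group)
open import Data.Vec.Properties using ([]=⇒lookup; lookup⇒[]=; lookup-concat; lookup-replicate)
open import Relation.Nullary using (¬_; yes; no; contradiction)
open import Relation.Binary.PropositionalEquality using (_≡_; refl; sym; trans; cong; subst; subst₂; module ≡-Reasoning)

private
  variable
    m n : ℕ

∣p++q∣≡∣p∣+∣q∣ : (p : Subset m) (q : Subset n) → ∣ p ++ q ∣ ≡ ∣ p ∣ + ∣ q ∣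
∣p++q∣≡∣p∣+∣q∣ []            q = refl
∣p++q∣≡∣p∣+∣q∣ (inside  ∷ p) q = cong suc (∣p++q∣≡∣p∣+∣q∣ p q)
∣p++q∣≡∣p∣+∣q∣ (outside ∷ p) q = ∣p++q∣≡∣p∣+∣q∣ p q

∣concat-replicate∣ : (m : ℕ) (p : Subset n) → ∣ concat (replicate m p) ∣ ≡ m * ∣ p ∣
∣concat-replicate∣ zero    p = refl
∣concat-replicate∣ (suc m) p =
  trans (∣p++q∣≡∣p∣+∣q∣ p _) (cong (∣ p ∣ +_) (∣concat-replicate∣ m p))

nonempty⇒1≤∣p∣ : {p : Subset n} → Nonempty p → 1 ≤ ∣ p ∣
nonempty⇒1≤∣p∣ (_ , x∈p) = ≤-trans (s≤s z≤n) (x∈p⇒∣p-x∣<∣p∣ x∈p)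

nonempty-blocks⇒length≤∣concat∣ : (xss : Vec (Subset n) m) →
  (∀ i → Nonempty (lookup xss i)) → m ≤ ∣ concat xss ∣
nonempty-blocks⇒length≤∣concat∣ []        _  = z≤n
nonempty-blocks⇒length≤∣concat∣ {m = suc m} (p ∷ xss) ne = begin
  1 + m                    ≤⟨ +-mono-≤ (nonempty⇒1≤∣p∣ (ne zero))
                                       (nonempty-blocks⇒length≤∣concat∣ xss (λ i → ne (suc i))) ⟩
  ∣ p ∣ + ∣ concat xss ∣   ≡⟨ sym (∣p++q∣≡∣p∣+∣q∣ p (concat xss)) ⟩
  ∣ p ++ concat xss ∣      ∎
  where open ≤-Reasoning

∈-concat⁺ : {xss : Vec (Subset n) m} {i : Fin m} {j : Fin n} →
  j ∈ lookup xss i → combine i j ∈ concat xss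
∈-concat⁺ {xss = xss} {i} {j} j∈ =
  lookup⇒[]= _ (concat xss) (trans (lookup-concat xss i j) ([]=⇒lookup j∈))

∈-concat⁻ : {xss : Vec (Subset n) m} {x : Fin (m * n)} →
  x ∈ concat xss → proj₂ (remQuot {m} n x) ∈ lookup xss (proj₁ (remQuot {m} n x))
∈-concat⁻ {n = n} {m} {xss} {x} x∈ = lookup⇒[]= j (lookup xss i) (begin
  lookup (lookup xss i) j           ≡⟨ sym (lookup-concat xss i j) ⟩
  lookup (concat xss) (combine i j) ≡⟨ cong (lookup (concat xss)) (combine-remQuot {m} n x) ⟩
  lookup (concat xss) x             ≡⟨ []=⇒lookup x∈ ⟩
  inside                            ∎)
  where
  open ≡-Reasoning
  i = proj₁ (remQuot {m} n x)
  j = proj₂ (remQuot {m} n x)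

meets-every-block⇒m≤∣S∣ : (S : Subset (m * n)) →
  (∀ i → ∃[ x ] (x ∈ S × proj₁ (remQuot {m} n x) ≡ i)) → m ≤ ∣ S ∣
meets-every-block⇒m≤∣S∣ {m} {n} S meets with group m n S
... | xss , refl = nonempty-blocks⇒length≤∣concat∣ xss λ i →
  let x , x∈ , x-in-i = meets i
      j = proj₂ (remQuot {m} n x)
  in j , subst (λ i → j ∈ lookup xss i) x-in-i (∈-concat⁻ {xss = xss} x∈)

module Corona {m : ℕ} (H : Graph m) (d : ℕ) where

  G : Graph (m * suc d)
  G = corona H d

  column : Fin (m * suc d) → Fin m
  column x = proj₁ (remQuot {m} (suc d) x)

  level : Fin (m * suc d) → ℕ
  level x = toℕ (proj₂ (remQuot {m} (suc d) x))

  column-adj : ∀ {v} {i j : Fin (suc d)} →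
    CoronaAdj d H (v , i) (v , j) → Adj G (combine v i) (combine v j)
  column-adj {v} {i} {j} =
    subst₂ (CoronaAdj d H) (sym (remQuot-combine v i)) (sym (remQuot-combine v j))

  step-stays-in-column : ∀ {u v k} {i j : Fin (suc d)} → CoronaAdj d H (u , i) (v , j) →
    suc k ≤ toℕ i → u ≡ v × k ≤ toℕ j
  step-stays-in-column (inj₁ (i≡0 , _))          k<i = contradiction (subst (_ ≤_) i≡0 k<i) λ ()
  step-stays-in-column (inj₂ (u≡v , inj₁ j≡1+i)) k<i =
    u≡v , subst (_ ≤_) (sym j≡1+i) (m≤n⇒m≤1+n (<⇒≤ k<i))
  step-stays-in-column (inj₂ (u≡v , inj₂ i≡1+j)) k<i = u≡v , s≤s⁻¹ (subst (_ ≤_) i≡1+j k<i)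

  walk-stays-in-column : ∀ {k x y} → Walk G k x y → k ≤ level x → column y ≡ column x
  walk-stays-in-column here                  _  = refl
  walk-stays-in-column {suc k} (step x~w w) k< =
    let x≡w , k≤w = step-stays-in-column x~w k< in trans (walk-stays-in-column w k≤w) (sym x≡w)

  far-end : Fin m → Fin (m * suc d)
  far-end v = combine v (fromℕ d)

  column-far-end : ∀ v → column (far-end v) ≡ v
  column-far-end v = cong proj₁ (remQuot-combine v (fromℕ d))

  level-far-end : ∀ v → level (far-end v) ≡ d
  level-far-end v =
    trans (cong (λ p → toℕ (proj₂ p)) (remQuot-combine v (fromℕ d))) (toℕ-fromℕ d)

  dominating-meets-every-column : ∀ {S} → IsDistDominating G d S →
    ∀ v → ∃[ x ] (x ∈ S × column x ≡ v)
  dominating-meets-every-column {S} dom v with far-end v ∈? S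
  ... | yes end∈ = far-end v , end∈ , column-far-end v
  ... | no  end∉ =
    let s , s∈ , k , k≤d , walk = dom (far-end v) end∉ in
    s , s∈ , trans (walk-stays-in-column walk (subst (k ≤_) (sym (level-far-end v)) k≤d))
                   (column-far-end v)

  m≤∣dominating∣ : ∀ {S} → IsDistDominating G d S → m ≤ ∣ S ∣
  m≤∣dominating∣ {S} dom = meets-every-block⇒m≤∣S∣ S (dominating-meets-every-column dom)

module Attachments {m : ℕ} (H : Graph m) (e : ℕ) where

  d : ℕ
  d = suc e

  open Corona H d

  one : Fin (suc d)
  one = suc zero

  attachments : Subset (m * suc d)
  attachments = concat (replicate m ⁅ one ⁆)

  ∣attachments∣ : ∣ attachments ∣ ≡ m
  ∣attachments∣ = begin
    ∣ concat (replicate m ⁅ one ⁆) ∣ ≡⟨ ∣concat-replicate∣ m ⁅ one ⁆ ⟩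
    m * ∣ ⁅ one ⁆ ∣                  ≡⟨ cong (m *_) (∣⁅x⁆∣≡1 one) ⟩
    m * 1                            ≡⟨ *-identityʳ m ⟩
    m                                ∎
    where open ≡-Reasoning

  one∈attachments : ∀ (v : Fin m) → combine v one ∈ attachments
  one∈attachments v = ∈-concat⁺ {xss = replicate m ⁅ one ⁆}
    (subst (one ∈_) (sym (lookup-replicate v ⁅ one ⁆)) (x∈⁅x⁆ one))

  attachment-at-one : ∀ {x} → x ∈ attachments → proj₂ (remQuot {m} (suc d) x) ≡ one
  attachment-at-one {x} x∈ = x∈⁅y⁆⇒x≡y one
    (subst (proj₂ (remQuot {m} (suc d) x) ∈_) (lookup-replicate (column x) ⁅ one ⁆)
           (∈-concat⁻ {xss = replicate m ⁅ one ⁆} x∈))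

  ones-nonadjacent : ∀ {u v} → ¬ CoronaAdj d H (u , one) (v , one)
  ones-nonadjacent (inj₁ (() , _))
  ones-nonadjacent (inj₂ (_ , inj₁ ()))
  ones-nonadjacent (inj₂ (_ , inj₂ ()))

  attachments-independent : IsIndependent G attachments
  attachments-independent u v u∈ v∈ =
    subst₂ (λ i j → ¬ CoronaAdj d H (column u , i) (column v , j))
           (sym (attachment-at-one u∈)) (sym (attachment-at-one v∈)) ones-nonadjacent

  walk-down : ∀ {v : Fin m} t (i : Fin (suc d)) → toℕ i ≡ suc t →
    Walk G t (combine v i) (combine v one)
  walk-down zero    (suc zero) refl  = here
  walk-down (suc t) (suc i)    i≡2+t =
    step (column-adj (inj₂ (refl , inj₂ (cong suc (sym (toℕ-inject₁ i))))))
         (walk-down t (inject₁ i) (trans (toℕ-inject₁ i) (suc-injective i≡2+t)))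

  near-one : ∀ (v : Fin m) (i : Fin (suc d)) → DistLe G d (combine v i) (combine v one)
  near-one v zero    = 1 , s≤s z≤n , step (column-adj (inj₂ (refl , inj₁ refl))) here
  near-one v (suc i) = toℕ i , <⇒≤ (toℕ<n i) , walk-down (toℕ i) (suc i) refl

  attachments-dominating : IsDistDominating G d attachments
  attachments-dominating x _ =
    combine (column x) one , one∈attachments (column x) ,
    subst (λ y → DistLe G d y (combine (column x) one)) (combine-remQuot {m} (suc d) x)
          (near-one (column x) (proj₂ (remQuot {m} (suc d) x)))

  corona-indepDistDomNumber : IsIndepDistDomNumber G d m
  corona-indepDistDomNumber =
    (attachments , (attachments-independent , attachments-dominating) , ∣attachments∣) ,
    λ S (_ , dom) → m≤∣dominating∣ dom

-- Simplicity and bipartiteness of H are not needed: the value is m for every graph H.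
proposition3p1 : (d : ℕ) → 2 ≤ d → (m : ℕ) → (H : Graph m) →
    IsSimple H → IsBipartite H →
    ∃[ γ ] (IsIndepDistDomNumber (corona H d) d γ × γ * suc d ≡ m * suc d)
proposition3p1 (suc e) (s≤s _) m H _ _ = m , Attachments.corona-indepDistDomNumber H e , refl
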